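{- Let $T,S$ be teams. The following are equivalent: (1) $T\equiv_{\mathrm{st}}S$; (2) for all teams $T_1,T_2$ with $T=T_1\cup T_2$ there are teams $S_1,S_2$ with $S=S_1\cup S_2$ and $T_i\equiv_{\mathrm{st}}S_i$ for $i\in\{1,2\}$.
   Context: A trace is an infinite sequence $t=t(0)t(1)\cdots$ of sets of propositions; a team is a set of traces. A stuttering function of a trace $t$ is a strictly increasing $f:\mathbb N\to\mathbb N$ with $f(0)=0$ and $t(f(k))=\cdots=t(f(k+1)-1)$ for all $k$; a stuttering function of a team is one that is a stuttering function of each of its traces. For $f:\mathbb N\to\mathbb N$, $t[f]=t(f(0))t(f(1))\cdots$ and $T[f]=\{t[f]\mid t\in T\}$. $T\equiv_{\mathrm{st}}T'$ (stutter-equivalence) means there are stuttering functions $f$ of $T$ and $f'$ of $T'$ with $T[f]=T'[f']$. -}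

module Defs where

open import Data.Nat using (ℕ; zero; suc; _≤_; _<_)
open import Data.Product using (Σ; ∃; _×_)
open import Data.Sum using (_⊎_)
open import Relation.Binary.PropositionalEquality using (_≡_)

-- The alphabet A stands for the powerset 2^AP of the set of propositions;
-- the notions below are uniform in the alphabet.

Trace : Set → Set
Trace A = ℕ → A

Team : Set → Set₁
Team A = Trace A → Set

_≈ₜ_ : {A : Set} → Trace A → Trace A → Set
t ≈ₜ u = ∀ n → t n ≡ u n

_≐_ : {A : Set} → Team A → Team A → Set
T ≐ T' = ∀ t → (T t → T' t) × (T' t → T t)

_∪_ : {A : Set} → Team A → Team A → Team A
(T₁ ∪ T₂) t = T₁ t ⊎ T₂ t

StrictlyIncreasing : (ℕ → ℕ) → Set
StrictlyIncreasing f = ∀ n → f n < f (suc n)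

IsStutteringFunction : {A : Set} → Trace A → (ℕ → ℕ) → Set
IsStutteringFunction t f =
  StrictlyIncreasing f × f 0 ≡ 0 ×
  (∀ k i → f k ≤ i → i < f (suc k) → t i ≡ t (f k))

IsTeamStutteringFunction : {A : Set} → Team A → (ℕ → ℕ) → Set
IsTeamStutteringFunction T f = ∀ t → T t → IsStutteringFunction t f

_[_]ₜ : {A : Set} → Trace A → (ℕ → ℕ) → Trace A
(t [ f ]ₜ) n = t (f n)

_[_] : {A : Set} → Team A → (ℕ → ℕ) → Team A
(T [ f ]) u = ∃ λ t → T t × (u ≈ₜ (t [ f ]ₜ))

_≡st_ : {A : Set} → Team A → Team A → Set
T ≡st T' = Σ (ℕ → ℕ) λ f → Σ (ℕ → ℕ) λ f' →
  IsTeamStutteringFunction T f × IsTeamStutteringFunction T' f' ×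
  ((T [ f ]) ≐ (T' [ f' ]))

-- Fix sampling functions f, f' witnessing T ≡st S.  Any subteam T' of T is
-- stutter-equivalent, via the same f and f', to the traces of S whose sample
-- under f' is the sample under f of some trace of T'; for T = T₁ ∪ T₂ these
-- matching teams cover S.  Conversely, split T as T ∪ ∅: a team
-- stutter-equivalent to ∅ is empty, so the partner of T is S itself.

module Submission where

open import Defs
open import Data.Nat using (ℕ)
open import Data.Empty using (⊥-elim)
open import Data.Product using (Σ; _×_; _,_; proj₁; proj₂)
open import Data.Sum using (inj₁; inj₂)
open import Function.Base using (_∘_)
open import Function.Bundles using (_⇔_; mk⇔)
open import Relation.Binary.PropositionalEquality using (refl; sym; trans)
open import Relation.Unary using (_⊆_; ∅)

private variable
  A : Set
  T T' S S' S₁ S₂ : Team A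
  f : ℕ → ℕ

≐-trans : T ≐ T' → T' ≐ S → T ≐ S
≐-trans T≐T' T'≐S t =
  (λ t∈T → proj₁ (T'≐S t) (proj₁ (T≐T' t) t∈T)) ,
  (λ t∈S → proj₂ (T≐T' t) (proj₂ (T'≐S t) t∈S))

≐-sym : T ≐ T' → T' ≐ T
≐-sym T≐T' t = proj₂ (T≐T' t) , proj₁ (T≐T' t)

≐⇒⊆ : T ≐ T' → T ⊆ T'
≐⇒⊆ T≐T' = proj₁ (T≐T' _)

≐⇒⊇ : T ≐ T' → T' ⊆ T
≐⇒⊇ T≐T' = proj₂ (T≐T' _)

∪-identityʳ : T ≐ (T ∪ ∅)
∪-identityʳ t = inj₁ , λ { (inj₁ t∈T) → t∈T ; (inj₂ ()) }

∪-absorbs-empty : S₂ ⊆ ∅ → (S₁ ∪ S₂) ≐ S₁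
∪-absorbs-empty S₂⊆∅ s =
  (λ { (inj₁ s∈S₁) → s∈S₁ ; (inj₂ s∈S₂) → ⊥-elim (S₂⊆∅ s∈S₂) }) , inj₁

stuttering-antitone : T' ⊆ T → IsTeamStutteringFunction T f → IsTeamStutteringFunction T' f
stuttering-antitone T'⊆T f-stutters t t∈T' = f-stutters t (T'⊆T t∈T')

sample-monotone : T ⊆ T' → (T [ f ]) ⊆ (T' [ f ])
sample-monotone T⊆T' (t , t∈T , u≈t[f]) = t , T⊆T' t∈T , u≈t[f]

sample-resp-≐ : T ≐ T' → (T [ f ]) ≐ (T' [ f ])
sample-resp-≐ T≐T' u = sample-monotone (≐⇒⊆ T≐T') , sample-monotone (≐⇒⊇ T≐T')

≡st-respʳ-≐ : S ≐ S' → T ≡st S → T ≡st S'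
≡st-respʳ-≐ S≐S' (f , f' , f-stutters , f'-stutters , T[f]≐S[f']) =
  f , f' , f-stutters , stuttering-antitone (≐⇒⊇ S≐S') f'-stutters ,
  ≐-trans T[f]≐S[f'] (sample-resp-≐ S≐S')

≡st-empty : ∅ ≡st S → S ⊆ ∅
≡st-empty (_ , _ , _ , _ , ∅[f]≐S[f']) {s} s∈S
  with _ , () , _ ← ≐⇒⊇ ∅[f]≐S[f'] (s , s∈S , λ _ → refl)

module Matching {A : Set} {T S : Team A} {f f' : ℕ → ℕ}
  (f-stutters : IsTeamStutteringFunction T f)
  (f'-stutters : IsTeamStutteringFunction S f')
  (T[f]≐S[f'] : (T [ f ]) ≐ (S [ f' ])) where

  matching : Team A → Team A
  matching T' s = S s × Σ (Trace A) λ t → T' t × ((s [ f' ]ₜ) ≈ₜ (t [ f ]ₜ))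

  ≡st-matching : {T' : Team A} → T' ⊆ T → T' ≡st matching T'
  ≡st-matching {T'} T'⊆T =
    f , f' , stuttering-antitone T'⊆T f-stutters , (λ s → f'-stutters s ∘ proj₁) ,
    λ u → to u , from u
    where
      to : ∀ u → (T' [ f ]) u → (matching T' [ f' ]) u
      to u (t , t∈T' , u≈t[f]) with ≐⇒⊆ T[f]≐S[f'] (t , T'⊆T t∈T' , u≈t[f])
      ... | s , s∈S , u≈s[f'] =
        s , (s∈S , t , t∈T' , λ n → trans (sym (u≈s[f'] n)) (u≈t[f] n)) , u≈s[f']

      from : ∀ u → (matching T' [ f' ]) u → (T' [ f ]) u
      from u (s , (_ , t , t∈T' , s[f']≈t[f]) , u≈s[f']) =
        t , t∈T' , λ n → trans (u≈s[f'] n) (s[f']≈t[f] n)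

  matching-cover : {T₁ T₂ : Team A} → T ≐ (T₁ ∪ T₂) → S ≐ (matching T₁ ∪ matching T₂)
  matching-cover {T₁} {T₂} T≐T₁∪T₂ s = to , from
    where
      to : S s → (matching T₁ ∪ matching T₂) s
      to s∈S with ≐⇒⊇ T[f]≐S[f'] (s , s∈S , λ _ → refl)
      ... | t , t∈T , s[f']≈t[f] with ≐⇒⊆ T≐T₁∪T₂ t∈T
      ... | inj₁ t∈T₁ = inj₁ (s∈S , t , t∈T₁ , s[f']≈t[f])
      ... | inj₂ t∈T₂ = inj₂ (s∈S , t , t∈T₂ , s[f']≈t[f])

      from : (matching T₁ ∪ matching T₂) s → S s
      from (inj₁ (s∈S , _)) = s∈S
      from (inj₂ (s∈S , _)) = s∈S

SplitsTransfer : Team A → Team A → Set₁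
SplitsTransfer {A} T S = ∀ (T₁ T₂ : Team A) → T ≐ (T₁ ∪ T₂) →
  Σ (Team A) λ S₁ → Σ (Team A) λ S₂ → (S ≐ (S₁ ∪ S₂)) × (T₁ ≡st S₁) × (T₂ ≡st S₂)

≡st⇒splitsTransfer : T ≡st S → SplitsTransfer T S
≡st⇒splitsTransfer (_ , _ , f-stutters , f'-stutters , T[f]≐S[f']) T₁ T₂ T≐T₁∪T₂ =
  matching T₁ , matching T₂ , matching-cover T≐T₁∪T₂ ,
  ≡st-matching (≐⇒⊇ T≐T₁∪T₂ ∘ inj₁) , ≡st-matching (≐⇒⊇ T≐T₁∪T₂ ∘ inj₂)
  where open Matching f-stutters f'-stutters T[f]≐S[f']

splitsTransfer⇒≡st : SplitsTransfer T S → T ≡st S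
splitsTransfer⇒≡st {T = T} transfer with transfer T ∅ ∪-identityʳ
... | S₁ , S₂ , S≐S₁∪S₂ , T≡stS₁ , ∅≡stS₂ =
  ≡st-respʳ-≐ (≐-sym (≐-trans S≐S₁∪S₂ (∪-absorbs-empty (≡st-empty ∅≡stS₂)))) T≡stS₁

lemma24 : {A : Set} (T S : Team A) →
    (T ≡st S) ⇔
    (∀ (T₁ T₂ : Team A) → T ≐ (T₁ ∪ T₂) →
    Σ (Team A) λ S₁ → Σ (Team A) λ S₂ →
    (S ≐ (S₁ ∪ S₂)) × (T₁ ≡st S₁) × (T₂ ≡st S₂))
lemma24 T S = mk⇔ ≡st⇒splitsTransfer splitsTransfer⇒≡st
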